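{- Let $G$ be a graph with universal homotopy cover $\rho:U\to G$ (based at a vertex $v$), and let $S\le D(G)$ be a subgroup. Define $r:U/S\to G$ by $r([u])=\rho(u)$. Then $r$ is well defined and is a homotopy covering map.
   Context: All graphs are undirected, have no multiple edges, may have loops, are connected, and are not a single isolated vertex. A walk is a sequence $(v_0\cdots v_n)$ with $v_i\sim v_{i+1}$; $N_2(v)$ is the set of walks of length 2 starting at $v$. A homotopy covering map is a morphism $f:\widetilde G\to G$ such that for every vertex $\tilde v$, applying $f$ vertexwise gives a bijection $N_2(\tilde v)\to N_2(f(\tilde v))$ respecting endpoints (two walks in $N_2(\tilde v)$ end at the same vertex iff their images do). A prune of a walk with $v_i=v_{i+2}$ replaces the segment $v_iv_{i+1}v_i$ by $v_i$; a spider move on $(v_0\cdots v_n)$ replaces one vertex $v_i$, $0<i<n$, by $v_i'$ with $v_{i-1}\sim v_i'\sim v_{i+1}$; walks are equivalent if connected by finitely many prunes, inverse prunes and spider moves. $\Pi(G)$ is the groupoid with objects the vertices and arrows the equivalence classes of walks, composed by concatenation ($\alpha*\beta$ = $\alpha$ then $\beta$); $\Pi_v(G)$ is the set of arrows with source $v$. The universal homotopy cover $U=U_vG$ has vertices the arrows of $\Pi_v(G)$, with $\alpha\sim\beta$ iff $\beta=\alpha*[(wx)]$ for an edge $w\sim x$ with $w$ the target of $\alpha$; $\rho$ sends an arrow to its target. $D(G)$ is the group of graph automorphisms $\varphi$ of $U$ with $\rho\circ\varphi=\rho$. For $S\le D(G)$, $U/S$ is the graph whose vertices are the $S$-orbits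 $[u]$ of vertices of $U$, with $[u]\sim[w]$ iff there are representatives $u,w$ with $u\sim w$ in $U$. -}

module Defs where

open import Data.Product using (Σ; Σ-syntax; _×_; _,_; ∃-syntax)
open import Relation.Binary.PropositionalEquality using (_≡_)
open import Relation.Binary.Construct.Closure.Equivalence using (EqClosure)
open import Function using (_⇔_)

-- Graphs: undirected (symmetric adjacency), no multiple edges
-- (adjacency is proof-irrelevant), loops allowed, connected, and not a
-- single isolated vertex (there is at least one edge).

data Walk {V : Set} (E : V → V → Set) (x : V) : Set where
  stop : Walk E x
  step : (y : V) → E x y → Walk E y → Walk E x

target : {V : Set} {E : V → V → Set} {x : V} → Walk E x → V
target {x = x} stop = x
target (step y _ w) = target w

record Graph : Set₁ where
  field
    Vertex    : Set
    _∼_       : Vertex → Vertex → Set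
    ∼-sym     : ∀ {x y} → x ∼ y → y ∼ x
    ∼-prop    : ∀ {x y} (p q : x ∼ y) → p ≡ q
    connected : ∀ x y → Σ[ w ∈ Walk _∼_ x ] target w ≡ y
    has-edge  : Σ[ x ∈ Vertex ] Σ[ y ∈ Vertex ] x ∼ y

module _ (G : Graph) where
  open Graph G

  W : Vertex → Set
  W = Walk _∼_

  data Step : {x : Vertex} → W x → W x → Set where
    prune  : ∀ {x y} (p : x ∼ y) (q : y ∼ x) (w : W x) →
             Step (step y p (step x q w)) w
    spider : ∀ {x y y' z} (p : x ∼ y) (q : y ∼ z) (p' : x ∼ y') (q' : y' ∼ z)
             (w : W z) →
             Step (step y p (step z q w)) (step y' p' (step z q' w))
    there  : ∀ {x y} (p : x ∼ y) {w w' : W y} → Step w w' →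
             Step (step y p w) (step y p w')

  _≃_ : {x : Vertex} → W x → W x → Set
  _≃_ {x} = EqClosure (Step {x})

  snoc : {x : Vertex} (α : W x) (y : Vertex) → target α ∼ y → W x
  snoc stop y e = step y e stop
  snoc (step z p w) y e = step z p (snoc w y e)

-- Graphs whose vertex set is given as a setoid (needed for U and U/S,
-- whose vertices are equivalence classes).

record SGraph : Set₁ where
  field
    Vtx  : Set
    _≈_  : Vtx → Vtx → Set
    _~_  : Vtx → Vtx → Set

toSGraph : Graph → SGraph
toSGraph G = record { Vtx = Graph.Vertex G ; _≈_ = _≡_ ; _~_ = Graph._∼_ G }

-- N₂(a) = walks (a b c) of length 2 from a, identified up to ≈ in b, c.
record IsHomotopyCover (A B : SGraph) (f : SGraph.Vtx A → SGraph.Vtx B) : Set where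
  open SGraph A renaming (Vtx to VA; _≈_ to _≈A_; _~_ to _~A_)
  open SGraph B renaming (Vtx to VB; _≈_ to _≈B_; _~_ to _~B_)
  field
    well-defined : ∀ {a a'} → a ≈A a' → f a ≈B f a'
    hom          : ∀ {a a'} → a ~A a' → f a ~B f a'
    N₂-injective : ∀ a {b c b' c'} → a ~A b → b ~A c → a ~A b' → b' ~A c' →
                   f b ≈B f b' → f c ≈B f c' → (b ≈A b') × (c ≈A c')
    N₂-surjective : ∀ a {d e} → f a ~B d → d ~B e →
                    Σ[ b ∈ VA ] Σ[ c ∈ VA ] (a ~A b) × (b ~A c) ×
                      (f b ≈B d) × (f c ≈B e)
    N₂-endpoints : ∀ a {b c b' c'} → a ~A b → b ~A c → a ~A b' → b' ~A c' →
                   (c ≈A c') ⇔ (f c ≈B f c')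

module _ (G : Graph) (v : Graph.Vertex G) where
  open Graph G

  ρ : W G v → Vertex
  ρ = target

  -- U: vertices = arrows of Π_v(G) (walks from v up to ≃);
  -- α ∼ β iff β = α * [(w x)] for an edge w ∼ x, w the target of α
  -- (stated on classes: for some representative α' of α).
  U : SGraph
  U = record
    { Vtx = W G v
    ; _≈_ = _≃_ G
    ; _~_ = λ α β → Σ[ α' ∈ W G v ] Σ[ x ∈ Vertex ] Σ[ e ∈ target α' ∼ x ]
                      (_≃_ G α α') × (_≃_ G β (snoc G α' x e))
    }

  open SGraph U using () renaming (_≈_ to _≈U_; _~_ to _~U_)

  record Deck : Set where
    field
      to       : W G v → W G v
      from     : W G v → W G v
      to-cong  : ∀ {α β} → α ≈U β → to α ≈U to β
      from-cong : ∀ {α β} → α ≈U β → from α ≈U from β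
      to-from  : ∀ α → to (from α) ≈U α
      from-to  : ∀ α → from (to α) ≈U α
      adj      : ∀ {α β} → (α ~U β) ⇔ (to α ~U to β)
      over-ρ   : ∀ α → ρ (to α) ≡ ρ α

  open Deck

  _≈D_ : Deck → Deck → Set
  φ ≈D ψ = ∀ α → to φ α ≈U to ψ α

  record Subgroup : Set₁ where
    field
      member     : Deck → Set
      member-resp : ∀ {φ ψ} → φ ≈D ψ → member φ → member ψ
      has-id     : ∀ φ → (∀ α → to φ α ≈U α) → member φ
      closed-∘   : ∀ φ ψ χ → member φ → member ψ →
                   (∀ α → to χ α ≈U to φ (to ψ α)) → member χ
      closed-inv : ∀ φ ψ → member φ →
                   (∀ α → to ψ α ≈U from φ α) → member ψ

  -- U/S: vertices are S-orbits; [u] ∼ [w] iff some representatives are adjacent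
  module _ (S : Subgroup) where
    open Subgroup S

    _≈S_ : W G v → W G v → Set
    u ≈S w = Σ[ φ ∈ Deck ] member φ × (to φ u ≈U w)

    U/S : SGraph
    U/S = record
      { Vtx = W G v
      ; _≈_ = _≈S_
      ; _~_ = λ u w → Σ[ u' ∈ W G v ] Σ[ w' ∈ W G v ]
                        (u ≈S u') × (w ≈S w') × (u' ~U w')
      }

-- A deck transformation moves U-adjacency to U-adjacency over the same vertices of G, so every
-- edge of U/S lifts, up to the action of S, to an edge of U. In U the neighbours of an arrow α
-- are the arrows α * [(target α) x], one for each neighbour x of target α, and the two-step
-- extensions of α ending at the same vertex are all equivalent by a single spider move at the
-- end. Hence a walk of length at most 2 in U/S is determined, up to S, by its image in G, and
-- every walk in G starting at ρ([u]) is the image of the walk u, u * [e], u * [e] * [e'].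
module Submission where

open import Defs hiding (_≈S_)
open import Data.Product using (Σ-syntax; _×_; _,_)
open import Function using (mk⇔; Equivalence)
open import Relation.Binary.PropositionalEquality
  using (_≡_; refl; sym; trans; cong; subst; subst₂; isEquivalence)
open import Relation.Binary.Structures using (IsEquivalence)
open import Relation.Binary.Construct.Closure.ReflexiveTransitive using (ε; _◅_)
open import Relation.Binary.Construct.Closure.Symmetric using (fwd; bwd)
import Relation.Binary.Construct.Closure.Equivalence as EqClosure

module Walks (G : Graph) where
  open Graph G

  module _ {x : Vertex} where
    open IsEquivalence (EqClosure.isEquivalence (Step G {x})) public
      using () renaming (refl to ≃-refl; sym to ≃-sym; trans to ≃-trans)

  ≡⇒≃ : ∀ {x} {w w' : W G x} → w ≡ w' → _≃_ G w w'
  ≡⇒≃ refl = ≃-refl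

  target-step : ∀ {x} {w w' : W G x} → Step G w w' → target w ≡ target w'
  target-step (prune p q w)          = refl
  target-step (spider p q p' q' w)   = refl
  target-step (there p s)            = target-step s

  target-resp : ∀ {x} {w w' : W G x} → _≃_ G w w' → target w ≡ target w'
  target-resp = EqClosure.gfold isEquivalence target target-step

  target-snoc : ∀ {x y} (w : W G x) (e : target w ∼ y) → target (snoc G w y e) ≡ y
  target-snoc stop         e = refl
  target-snoc (step z p w) e = target-snoc w e

  snoc-step : ∀ {x y} {w w' : W G x} → Step G w w' →
              (e : target w ∼ y) (e' : target w' ∼ y) → Step G (snoc G w y e) (snoc G w' y e')
  snoc-step (prune p q w) e e' rewrite ∼-prop e e' = prune p q _
  snoc-step (spider p q p' q' w) e e' rewrite ∼-prop e e' = spider p q p' q' _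
  snoc-step (there p s) e e' = there p (snoc-step s e e')

  snoc-cong : ∀ {x y y'} {w w' : W G x} → _≃_ G w w' → y ≡ y' →
              (e : target w ∼ y) (e' : target w' ∼ y') → _≃_ G (snoc G w y e) (snoc G w' y' e')
  snoc-cong {w = w} ε refl e e' = ≡⇒≃ (cong (snoc G w _) (∼-prop e e'))
  snoc-cong {y = y} (fwd s ◅ r) refl e e' =
    fwd (snoc-step s e e₁) ◅ snoc-cong r refl e₁ e'
    where e₁ = subst (_∼ y) (target-step s) e
  snoc-cong {y = y} (bwd s ◅ r) refl e e' =
    bwd (snoc-step s e₁ e) ◅ snoc-cong r refl e₁ e'
    where e₁ = subst (_∼ y) (sym (target-step s)) e

  snoc²-spider : ∀ {x y y' z} (w : W G x)
                 (e : target w ∼ y) (f : target (snoc G w y e) ∼ z)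
                 (e' : target w ∼ y') (f' : target (snoc G w y' e') ∼ z) →
                 Step G (snoc G (snoc G w y e) z f) (snoc G (snoc G w y' e') z f')
  snoc²-spider stop         e f e' f' = spider e f e' f' stop
  snoc²-spider (step u p w) e f e' f' = there p (snoc²-spider w e f e' f')

module Cover (G : Graph) (v : Graph.Vertex G) where
  open Graph G
  open Walks G
  open SGraph (U G v) public using () renaming (_~_ to _~U_)

  ~U-intro : ∀ {x} (α : W G v) (e : target α ∼ x) → α ~U snoc G α x e
  ~U-intro α e = α , _ , e , ≃-refl , ≃-refl

  ~U-resp : ∀ {α α₂ β β₂} → _≃_ G α α₂ → _≃_ G β β₂ → α ~U β → α₂ ~U β₂
  ~U-resp α≃ β≃ (α' , x , e , p , q) = α' , x , e , ≃-trans (≃-sym α≃) p , ≃-trans (≃-sym β≃) q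

  ~U-unfold : ∀ {α β} → α ~U β → Σ[ x ∈ Vertex ] Σ[ e ∈ target α ∼ x ] _≃_ G β (snoc G α x e)
  ~U-unfold (α' , x , e , p , q) = x , e₀ , ≃-trans q (snoc-cong (≃-sym p) refl e e₀)
    where e₀ = subst (_∼ x) (sym (target-resp p)) e

  ~U⇒∼ : ∀ {α β} → α ~U β → target α ∼ target β
  ~U⇒∼ {α} α~β with ~U-unfold α~β
  ... | x , e , q = subst (target α ∼_) (sym (trans (target-resp q) (target-snoc α e))) e

  ~U-unique : ∀ {α β β'} → α ~U β → α ~U β' → target β ≡ target β' → _≃_ G β β'
  ~U-unique {α} α~β α~β' eq with ~U-unfold α~β | ~U-unfold α~β'
  ... | x , e , q | x' , e' , q' = ≃-trans q (≃-trans (snoc-cong ≃-refl x≡x' e e') (≃-sym q'))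
    where
      x≡x' : x ≡ x'
      x≡x' = trans (sym (trans (target-resp q) (target-snoc α e)))
                   (trans eq (trans (target-resp q') (target-snoc α e')))

  ~U²-unfold : ∀ {α β γ z} → α ~U β → β ~U γ → target γ ≡ z →
               Σ[ x ∈ Vertex ] Σ[ e ∈ target α ∼ x ] Σ[ f ∈ target (snoc G α x e) ∼ z ]
                 _≃_ G γ (snoc G (snoc G α x e) z f)
  ~U²-unfold {β = β} α~β β~γ γ≡z with ~U-unfold α~β | ~U-unfold β~γ
  ... | x , e , q | y , f , r = x , e , f₀ , ≃-trans r (snoc-cong q y≡z f f₀)
    where
      y≡z = trans (sym (trans (target-resp r) (target-snoc β f))) γ≡z
      f₀  = subst₂ _∼_ (target-resp q) y≡z f

  ~U²-unique : ∀ {α β γ β' γ'} → α ~U β → β ~U γ → α ~U β' → β' ~U γ' →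
               target γ ≡ target γ' → _≃_ G γ γ'
  ~U²-unique {α} α~β β~γ α~β' β'~γ' eq
    with ~U²-unfold α~β β~γ eq | ~U²-unfold α~β' β'~γ' refl
  ... | x , e , f , r | x' , e' , f' , r' =
    ≃-trans r (fwd (snoc²-spider α e f e' f') ◅ ≃-sym r')

module DeckGroup (G : Graph) (v : Graph.Vertex G) where
  open Walks G
  open Cover G v
  open Deck

  idDeck : Deck G v
  idDeck = record
    { to = λ α → α ; from = λ α → α ; to-cong = λ p → p ; from-cong = λ p → p
    ; to-from = λ _ → ≃-refl ; from-to = λ _ → ≃-refl
    ; adj = mk⇔ (λ h → h) (λ h → h) ; over-ρ = λ _ → refl }

  _∘Deck_ : Deck G v → Deck G v → Deck G v
  φ ∘Deck ψ = record
    { to = λ α → to φ (to ψ α) ; from = λ α → from ψ (from φ α)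
    ; to-cong = λ p → to-cong φ (to-cong ψ p) ; from-cong = λ p → from-cong ψ (from-cong φ p)
    ; to-from = λ α → ≃-trans (to-cong φ (to-from ψ (from φ α))) (to-from φ α)
    ; from-to = λ α → ≃-trans (from-cong ψ (from-to φ (to ψ α))) (from-to ψ α)
    ; adj = mk⇔ (λ h → Equivalence.to (adj φ) (Equivalence.to (adj ψ) h))
                (λ h → Equivalence.from (adj ψ) (Equivalence.from (adj φ) h))
    ; over-ρ = λ α → trans (over-ρ φ (to ψ α)) (over-ρ ψ α) }

  invDeck : Deck G v → Deck G v
  invDeck φ = record
    { to = from φ ; from = to φ ; to-cong = from-cong φ ; from-cong = to-cong φ
    ; to-from = from-to φ ; from-to = to-from φ
    ; adj = λ {α} {β} → mk⇔
        (λ h → Equivalence.from (adj φ)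
                 (~U-resp (≃-sym (to-from φ α)) (≃-sym (to-from φ β)) h))
        (λ h → ~U-resp (to-from φ α) (to-from φ β) (Equivalence.to (adj φ) h))
    ; over-ρ = λ α → trans (sym (over-ρ φ (from φ α))) (target-resp (to-from φ α)) }

module Orbits (G : Graph) (v : Graph.Vertex G) (S : Subgroup G v) where
  open Graph G
  open Walks G
  open Cover G v
  open DeckGroup G v
  open Subgroup S
  open Deck
  open SGraph (U/S G v S) using () renaming (_≈_ to _≈S_; _~_ to _~S_)

  ≃⇒≈S : ∀ {u w} → _≃_ G u w → u ≈S w
  ≃⇒≈S p = idDeck , has-id idDeck (λ _ → ≃-refl) , p

  ≈S-refl : ∀ {u} → u ≈S u
  ≈S-refl = ≃⇒≈S ≃-refl

  ≈S-sym : ∀ {u w} → u ≈S w → w ≈S u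
  ≈S-sym {u} (φ , φ∈S , p) =
    invDeck φ , closed-inv φ (invDeck φ) φ∈S (λ _ → ≃-refl) ,
    ≃-trans (from-cong φ (≃-sym p)) (from-to φ u)

  ≈S-trans : ∀ {u w z} → u ≈S w → w ≈S z → u ≈S z
  ≈S-trans (φ , φ∈S , p) (ψ , ψ∈S , q) =
    ψ ∘Deck φ , closed-∘ ψ φ (ψ ∘Deck φ) ψ∈S φ∈S (λ _ → ≃-refl) , ≃-trans (to-cong ψ p) q

  ≈S⇒target≡ : ∀ {u w} → u ≈S w → target u ≡ target w
  ≈S⇒target≡ {u} (φ , _ , p) = trans (sym (over-ρ φ u)) (target-resp p)

  ~U⇒~S : ∀ {u w} → u ~U w → u ~S w
  ~U⇒~S {u} {w} h = u , w , ≈S-refl , ≈S-refl , h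

  ~S-respˡ : ∀ {a a' b} → a ≈S a' → a ~S b → a' ~S b
  ~S-respˡ a≈ (a₁ , b₁ , a≈a₁ , b≈b₁ , h) = a₁ , b₁ , ≈S-trans (≈S-sym a≈) a≈a₁ , b≈b₁ , h

  -- Pull the edge a₁ ~U b₁ back along the deck transformation carrying a to a₁.
  ~S-lift : ∀ {a b} → a ~S b → Σ[ b₀ ∈ W G v ] (b₀ ≈S b) × (a ~U b₀)
  ~S-lift {a} (a₁ , b₁ , (φ , φ∈S , φa≃a₁) , b≈b₁ , h) =
    from φ b₁ ,
    ≈S-trans (φ , φ∈S , to-from φ b₁) (≈S-sym b≈b₁) ,
    ~U-resp (≃-trans (from-cong φ (≃-sym φa≃a₁)) (from-to φ a)) ≃-refl
      (Equivalence.to (adj (invDeck φ)) h)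

  ~S⇒∼ : ∀ {a b} → a ~S b → target a ∼ target b
  ~S⇒∼ {a} a~b with ~S-lift a~b
  ... | b₀ , b₀≈b , h = subst (target a ∼_) (≈S⇒target≡ b₀≈b) (~U⇒∼ h)

  ~S-unique : ∀ {a b b'} → a ~S b → a ~S b' → target b ≡ target b' → b ≈S b'
  ~S-unique a~b a~b' eq with ~S-lift a~b | ~S-lift a~b'
  ... | b₀ , b₀≈b , h | b₀' , b₀'≈b' , h' =
    ≈S-trans (≈S-sym b₀≈b) (≈S-trans (≃⇒≈S (~U-unique h h' eq₀)) b₀'≈b')
    where eq₀ = trans (≈S⇒target≡ b₀≈b) (trans eq (sym (≈S⇒target≡ b₀'≈b')))

  ~S²-unique : ∀ {a b c b' c'} → a ~S b → b ~S c → a ~S b' → b' ~S c' →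
               target c ≡ target c' → c ≈S c'
  ~S²-unique a~b b~c a~b' b'~c' eq with ~S-lift a~b | ~S-lift a~b'
  ... | b₀ , b₀≈b , h₁ | b₀' , b₀'≈b' , h₁'
    with ~S-lift (~S-respˡ (≈S-sym b₀≈b) b~c) | ~S-lift (~S-respˡ (≈S-sym b₀'≈b') b'~c')
  ... | c₀ , c₀≈c , h₂ | c₀' , c₀'≈c' , h₂' =
    ≈S-trans (≈S-sym c₀≈c) (≈S-trans (≃⇒≈S (~U²-unique h₁ h₂ h₁' h₂' eq₀)) c₀'≈c')
    where eq₀ = trans (≈S⇒target≡ c₀≈c) (trans eq (sym (≈S⇒target≡ c₀'≈c')))

theorem3p30 : (G : Graph) (v : Graph.Vertex G) (S : Subgroup G v) →
    IsHomotopyCover (U/S G v S) (toSGraph G) (ρ G v)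
theorem3p30 G v S = record
  { well-defined  = ≈S⇒target≡
  ; hom           = ~S⇒∼
  ; N₂-injective  = λ a a~b b~c a~b' b'~c' eqb eqc →
      ~S-unique a~b a~b' eqb , ~S²-unique a~b b~c a~b' b'~c' eqc
  ; N₂-surjective = λ a {d} {e} a∼d d∼e →
      let b   = snoc G a d a∼d
          b∼e = subst (_∼ e) (sym (target-snoc a a∼d)) d∼e
      in b , snoc G b e b∼e , ~U⇒~S (~U-intro a a∼d) , ~U⇒~S (~U-intro b b∼e) ,
         target-snoc a a∼d , target-snoc b b∼e
  ; N₂-endpoints  = λ a a~b b~c a~b' b'~c' →
      mk⇔ ≈S⇒target≡ (~S²-unique a~b b~c a~b' b'~c')
  }
  where
    open Graph G
    open Walks G
    open Cover G v
    open Orbits G v S
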